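{- Let $n$ be even with $n<12$, and let $C=F_n;L_2$ be a two-layer comparator network on $n$ channels, where $F_n=\{(2i-1,2i):1\le i\le n/2\}$, such that every channel is used by a comparator of $L_2$ and $C$ is connected (any two channels are linked by a sequence of channels with consecutive ones joined by a comparator of $F_n$ or $L_2$). Then $C\approx C^R$.
   Context: A comparator network on $n$ channels is a sequence of layers; each layer is a set of comparators $(i,j)$, $1\le i<j\le n$, with each channel in at most one comparator of the layer. The reflection $C^R$ replaces each comparator $(i,j)$ with $(n-j+1,n-i+1)$ in the same layer. Graph representation: $\mathcal G(C)$ has one vertex per comparator; for a comparator $u$ in layer $k$ and a comparator $v$ in a later layer, there is an edge labeled $1$ (resp. $2$) from $u$ to $v$ if the smaller (resp. larger) channel of $u$ is used by $v$ and by no comparator in a layer strictly between. $C_1\approx C_2$ means $\mathcal G(C_1)$ and $\mathcal G(C_2)$ are isomorphic as edge-labeled directed graphs. -}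

module Defs where

open import Data.Nat using (ℕ; zero; suc)
open import Data.Fin using (Fin; zero; suc; _<_; opposite)
open import Data.Product using (Σ; _×_; _,_; proj₁; proj₂; ∃)
open import Data.Sum using (_⊎_)
open import Data.List using (List; []; _∷_; map; length; lookup; concatMap; reverse)
open import Data.List.Relation.Unary.All using (All)
open import Data.List.Relation.Unary.Unique.Propositional using (Unique)
open import Data.List.Membership.Propositional using (_∈_)
open import Relation.Binary.PropositionalEquality using (_≡_)
open import Relation.Binary.Construct.Closure.ReflexiveTransitive using (Star)
open import Relation.Nullary using (¬_)
open import Function.Bundles using (_⤖_; _⇔_; Bijection)

-- Channels are Fin n (0-indexed: channel c here is channel c+1 of the paper).
-- A comparator is a pair (i , j) of channels; valid when i < j.
Comparator : ℕ → Set
Comparator n = Fin n × Fin n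

Layer : ℕ → Set
Layer n = List (Comparator n)

-- A network is a list of layers (first layer first).
Network : ℕ → Set
Network n = List (Layer n)

channels : ∀ {n} → Layer n → List (Fin n)
channels = concatMap (λ c → proj₁ c ∷ proj₂ c ∷ [])

ValidLayer : ∀ {n} → Layer n → Set
ValidLayer L = All (λ c → proj₁ c < proj₂ c) L × Unique (channels L)

Uses : ∀ {n} → Fin n → Comparator n → Set
Uses ch c = ch ≡ proj₁ c ⊎ ch ≡ proj₂ c

UsedBy : ∀ {n} → Fin n → Layer n → Set
UsedBy ch L = Σ _ λ c → c ∈ L × Uses ch c

-- F_n = {(2i-1,2i)} in 1-indexed notation, i.e. {(2i,2i+1)} 0-indexed
shift2 : ∀ {n} → Comparator n → Comparator (suc (suc n))
shift2 (i , j) = (suc (suc i) , suc (suc j))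

F : (n : ℕ) → Layer n
F zero = []
F (suc zero) = []
F (suc (suc n)) = (zero , suc zero) ∷ map shift2 (F n)

reflectComp : ∀ {n} → Comparator n → Comparator n
reflectComp (i , j) = (opposite j , opposite i)

reflect : ∀ {n} → Network n → Network n
reflect = map (map reflectComp)

Adj : ∀ {n} → Network n → Fin n → Fin n → Set
Adj C a b = Σ _ λ L → L ∈ C × ((a , b) ∈ L ⊎ (b , a) ∈ L)

Connected : ∀ {n} → Network n → Set
Connected C = ∀ a b → Star (Adj C) a b

-- Graph representation G(C)
-- vertices: one per comparator, identified by (layer index , position in layer)
Vertex : ∀ {n} → Network n → Set
Vertex C = Σ (Fin (length C)) λ k → Fin (length (lookup C k))

comp : ∀ {n} (C : Network n) → Vertex C → Comparator n
comp C (k , a) = lookup (lookup C k) a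

data Label : Set where
  one two : Label

-- the channel of a comparator selected by the label (1 = smaller, 2 = larger)
sel : ∀ {n} → Label → Comparator n → Fin n
sel one c = proj₁ c
sel two c = proj₂ c

Edge : ∀ {n} (C : Network n) → Label → Vertex C → Vertex C → Set
Edge C l (k , a) (k' , b) =
  k < k' ×
  Uses (sel l (comp C (k , a))) (comp C (k' , b)) ×
  (∀ (m : Fin (length C)) → k < m → m < k' →
     ¬ UsedBy (sel l (comp C (k , a))) (lookup C m))

_≈_ : ∀ {n} → Network n → Network n → Set
C₁ ≈ C₂ = Σ (Vertex C₁ ⤖ Vertex C₂) λ f →
  ∀ l u v → Edge C₁ l u v ⇔ Edge C₂ l (Bijection.to f u) (Bijection.to f v)

module Submission where

-- In a two-layer network the only edges of 𝒢(C) run from the first layer to the second, an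
-- edge with label l from u to v existing iff the l-end of u is a channel of v.  Hence any
-- relabelling π of the channels that carries the comparators of one such network onto those
-- of another, respecting the labels in the first layer, induces an isomorphism of the graphs.
-- Reflection sends the a-th comparator of F to the (h−1−a)-th one with its ends exchanged, so
-- for C and Cᴿ it suffices to find an involution σ of the comparators of F such that the
-- channel map twist σ (move comparator a of F to σ a, exchanging its ends) commutes with the
-- perfect matching "partner" that L₂ induces on the channels.

open import Defs
open import Algebra.Definitions using (Involutive)
open import Data.Bool using (Bool; true; T; not; _∧_; if_then_else_)
open import Data.Bool.Properties using (T-∧; T-≡)
open import Data.Empty using (⊥; ⊥-elim)
open import Data.Fin as Fin using (Fin; zero; suc; cast; opposite; _≟_)
open import Data.Fin.Properties using (cast-trans; cast-involutive; cast-is-id; opposite-involutive; <⇒≢; all?)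
open import Data.List using (List; []; _∷_; map; length; lookup; allFin; filter; concatMap)
open import Data.List.Properties using (length-map)
open import Data.List.Membership.Propositional using (_∈_; find)
open import Data.List.Membership.Propositional.Properties using (∈-map⁻; ∈-filter⁻; ∈-lookup)
open import Data.List.Relation.Unary.All as All using (All)
open import Data.List.Relation.Unary.AllPairs using (_∷_)
open import Data.List.Relation.Unary.Any as Any using (Any; here; there; any?)
open import Data.List.Relation.Unary.Any.Properties using (lookup-index)
open import Data.List.Relation.Unary.Unique.Propositional using (Unique)
open import Data.Maybe using (Maybe; just; nothing; is-just; is-nothing; fromMaybe)
open import Data.Maybe.Properties using (just-injective)
open import Data.Nat using (ℕ; zero; suc; _*_; _<_; s≤s)
open import Data.Nat.Divisibility using (_∣_; divides)
open import Data.Nat.Properties using (*-cancelʳ-<)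
open import Data.Product using (Σ; _×_; _,_; proj₁; proj₂; map₁)
open import Data.Sum as Sum using (_⊎_; inj₁; inj₂)
open import Data.Vec.Functional using () renaming (_∷_ to _◂_)
open import Function using (_∘_)
open import Function.Bundles using (_↔_; _⇔_; mk⇔; mk↔ₛ′; Inverse; Equivalence)
open import Function.Properties.Inverse using (↔⇒⤖)
import Function.Properties.Equivalence as ⇔
open import Relation.Binary.PropositionalEquality
  using (_≡_; _≢_; refl; sym; trans; cong; cong₂; subst; module ≡-Reasoning)
open import Relation.Nullary using (Dec; yes; no; does)
open import Relation.Nullary.Decidable using (T?; True; isYes; toWitness; dec-false)

open ≡-Reasoning

lookup-map : ∀ {A B : Set} (f : A → B) (xs : List A) .(e : length xs ≡ length (map f xs))
  (i : Fin (length xs)) → lookup (map f xs) (cast e i) ≡ f (lookup xs i)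
lookup-map f (x ∷ xs) e zero = refl
lookup-map f (x ∷ xs) e (suc i) = lookup-map f xs _ i

involutive-injective : ∀ {A : Set} {f : A → A} → Involutive _≡_ f → ∀ {x y} → f x ≡ f y → x ≡ y
involutive-injective {f = f} f-inv {x} {y} e = begin
  x         ≡⟨ sym (f-inv x) ⟩
  f (f x)   ≡⟨ cong f e ⟩
  f (f y)   ≡⟨ f-inv y ⟩
  y         ∎

involution↔ : ∀ {m k k′} (σ : Fin m → Fin m) → Involutive _≡_ σ →
  .(k ≡ m) → .(m ≡ k′) → Fin k ↔ Fin k′
involution↔ σ σ-inv e e′ = mk↔ₛ′ (cast e′ ∘ σ ∘ cast e) (cast (sym e) ∘ σ ∘ cast (sym e′))
  (λ y → begin
    cast e′ (σ (cast e (cast (sym e) (σ (cast (sym e′) y)))))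
      ≡⟨ cong (cast e′ ∘ σ) (cast-involutive e (sym e) _) ⟩
    cast e′ (σ (σ (cast (sym e′) y)))  ≡⟨ cong (cast e′) (σ-inv _) ⟩
    cast e′ (cast (sym e′) y)          ≡⟨ cast-involutive e′ (sym e′) y ⟩
    y                                  ∎)
  (λ x → begin
    cast (sym e) (σ (cast (sym e′) (cast e′ (σ (cast e x)))))
      ≡⟨ cong (cast (sym e) ∘ σ) (cast-involutive (sym e′) e′ _) ⟩
    cast (sym e) (σ (σ (cast e x)))    ≡⟨ cong (cast (sym e)) (σ-inv _) ⟩
    cast (sym e) (cast e x)            ≡⟨ cast-involutive (sym e) e x ⟩
    x                                  ∎)

nothing-between : (m : Fin 2) → zero {1} Fin.< m → m Fin.< suc {1} zero → ⊥
nothing-between zero () _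
nothing-between (suc zero) _ (s≤s ())

module TwoLayerIsomorphism {n : ℕ} {A B A′ B′ : Layer n} (π : Fin n → Fin n)
  (α : Fin (length A) ↔ Fin (length A′)) (β : Fin (length B) ↔ Fin (length B′))
  (first : ∀ l a → sel l (lookup A′ (Inverse.to α a)) ≡ π (sel l (lookup A a)))
  (second : ∀ ch b → Uses ch (lookup B b) ⇔ Uses (π ch) (lookup B′ (Inverse.to β b)))
  where

  private
    C C′ : Network n
    C = A ∷ B ∷ []
    C′ = A′ ∷ B′ ∷ []

  vertices : Vertex C ↔ Vertex C′
  vertices = mk↔ₛ′ to from to∘from from∘to
    where
    to : Vertex C → Vertex C′
    to (zero , a) = zero , Inverse.to α a
    to (suc zero , b) = suc zero , Inverse.to β b
    from : Vertex C′ → Vertex C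
    from (zero , a) = zero , Inverse.from α a
    from (suc zero , b) = suc zero , Inverse.from β b
    to∘from : ∀ v → to (from v) ≡ v
    to∘from (zero , a) = cong (zero ,_) (Inverse.strictlyInverseˡ α a)
    to∘from (suc zero , b) = cong (suc zero ,_) (Inverse.strictlyInverseˡ β b)
    from∘to : ∀ v → from (to v) ≡ v
    from∘to (zero , a) = cong (zero ,_) (Inverse.strictlyInverseʳ α a)
    from∘to (suc zero , b) = cong (suc zero ,_) (Inverse.strictlyInverseʳ β b)

  shared-channel : ∀ l a b → Uses (sel l (lookup A a)) (lookup B b) ⇔
    Uses (sel l (lookup A′ (Inverse.to α a))) (lookup B′ (Inverse.to β b))
  shared-channel l a b = mk⇔
    (λ u → subst (λ c → Uses c _) (sym (first l a)) (Equivalence.to (second _ b) u))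
    (λ u → Equivalence.from (second _ b) (subst (λ c → Uses c _) (first l a) u))

  edges : ∀ l u v → Edge C l u v ⇔ Edge C′ l (Inverse.to vertices u) (Inverse.to vertices v)
  edges l (zero , a) (zero , b) = mk⇔ (λ { (() , _) }) (λ { (() , _) })
  edges l (zero , a) (suc zero , b) = mk⇔
    (λ { (lt , u , _) → lt , Equivalence.to (shared-channel l a b) u , between })
    (λ { (lt , u , _) → lt , Equivalence.from (shared-channel l a b) u , between })
    where
    between : ∀ {P : Fin 2 → Set} m → zero {1} Fin.< m → m Fin.< suc {1} zero → P m
    between m p q = ⊥-elim (nothing-between m p q)
  edges l (suc zero , a) (zero , b) = mk⇔ (λ { (() , _) }) (λ { (() , _) })
  edges l (suc zero , a) (suc zero , b) = mk⇔ (λ { (s≤s () , _) }) (λ { (s≤s () , _) })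

  isomorphic : C ≈ C′
  isomorphic = ↔⇒⤖ vertices , edges

uses-reflect : ∀ {n} {x : Fin n} (c : Comparator n) → Uses x c ⇔ Uses (opposite x) (reflectComp c)
uses-reflect (i , j) = mk⇔
  (λ { (inj₁ e) → inj₂ (cong opposite e) ; (inj₂ e) → inj₁ (cong opposite e) })
  (λ { (inj₁ e) → inj₂ (involutive-injective opposite-involutive e)
    ; (inj₂ e) → inj₁ (involutive-injective opposite-involutive e) })

flip : Label → Label
flip one = two
flip two = one

sel-reflect : ∀ {n} l (c : Comparator n) → sel l (reflectComp c) ≡ opposite (sel (flip l) c)
sel-reflect one c = refl
sel-reflect two c = refl

chan : ∀ {h} → Fin h → Label → Fin (h * 2)
chan zero one = zero
chan zero two = suc zero
chan (suc a) l = suc (suc (chan a l))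

pairF : ∀ {h} → Fin h → Comparator (h * 2)
pairF a = chan a one , chan a two

split : ∀ {h} → Fin (h * 2) → Fin h × Label
split {suc h} zero = zero , one
split {suc h} (suc zero) = zero , two
split {suc h} (suc (suc x)) = map₁ suc (split {h} x)

split-chan : ∀ {h} (a : Fin h) l → split (chan a l) ≡ (a , l)
split-chan zero one = refl
split-chan zero two = refl
split-chan (suc a) l = cong (map₁ suc) (split-chan a l)

chan-split : ∀ {h} (x : Fin (h * 2)) → chan {h} (proj₁ (split {h} x)) (proj₂ (split {h} x)) ≡ x
chan-split {suc h} zero = refl
chan-split {suc h} (suc zero) = refl
chan-split {suc h} (suc (suc x)) = cong (λ (y : Fin (h * 2)) → suc (suc y)) (chan-split {h} x)

twist : ∀ {h} → (Fin h → Fin h) → Fin (h * 2) → Fin (h * 2)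
twist {h} σ x = chan (σ (proj₁ (split {h} x))) (flip (proj₂ (split {h} x)))

twist-chan : ∀ {h} (σ : Fin h → Fin h) a l → twist σ (chan a l) ≡ chan (σ a) (flip l)
twist-chan σ a l = cong (λ p → chan (σ (proj₁ p)) (flip (proj₂ p))) (split-chan a l)

flip-involutive : Involutive _≡_ flip
flip-involutive one = refl
flip-involutive two = refl

twist-involutive : ∀ {h} (σ : Fin h → Fin h) → Involutive _≡_ σ → Involutive _≡_ (twist σ)
twist-involutive {h} σ σ-inv x = begin
  twist σ (twist σ x)                 ≡⟨ twist-chan σ (σ a) (flip l) ⟩
  chan (σ (σ a)) (flip (flip l))      ≡⟨ cong₂ chan (σ-inv a) (flip-involutive l) ⟩
  chan a l                            ≡⟨ chan-split {h} x ⟩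
  x                                   ∎
  where
  a = proj₁ (split {h} x)
  l = proj₂ (split {h} x)

length-F : ∀ h → length (F (h * 2)) ≡ h
length-F zero = refl
length-F (suc h) = cong suc (trans (length-map shift2 (F (h * 2))) (length-F h))

lookup-F : ∀ h .(e : h ≡ length (F (h * 2))) (a : Fin h) → lookup (F (h * 2)) (cast e a) ≡ pairF a
lookup-F (suc h) e zero = refl
lookup-F (suc h) e (suc a) = begin
  lookup (map shift2 (F (h * 2))) (cast _ a)
    ≡⟨ cong (lookup (map shift2 (F (h * 2)))) (sym (cast-trans (sym (length-F h)) lm a)) ⟩
  lookup (map shift2 (F (h * 2))) (cast lm (cast (sym (length-F h)) a))
    ≡⟨ lookup-map shift2 (F (h * 2)) _ _ ⟩
  shift2 (lookup (F (h * 2)) (cast (sym (length-F h)) a))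
    ≡⟨ cong shift2 (lookup-F h _ a) ⟩
  shift2 (pairF a) ∎
  where
  lm : length (F (h * 2)) ≡ length (map shift2 (F (h * 2)))
  lm = sym (length-map shift2 (F (h * 2)))

sel-pairF : ∀ {h} l (a : Fin h) → sel l (pairF a) ≡ chan a l
sel-pairF one a = refl
sel-pairF two a = refl

reflect-F↔ : ∀ h (σ : Fin h → Fin h) → Involutive _≡_ σ →
  Fin (length (F (h * 2))) ↔ Fin (length (map reflectComp (F (h * 2))))
reflect-F↔ h σ σ-inv = involution↔ σ σ-inv (length-F h)
  (trans (sym (length-F h)) (sym (length-map reflectComp (F (h * 2)))))

reflect-F : ∀ h (σ : Fin h → Fin h) (σ-inv : Involutive _≡_ σ) l i →
  sel l (lookup (map reflectComp (F (h * 2))) (Inverse.to (reflect-F↔ h σ σ-inv) i)) ≡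
  opposite (twist σ (sel l (lookup (F (h * 2)) i)))
reflect-F h σ σ-inv l i = begin
  sel l (lookup (map reflectComp Fh) (cast (trans (sym lF) lm) (σ a)))
    ≡⟨ cong (sel l ∘ lookup (map reflectComp Fh)) (sym (cast-trans (sym lF) lm (σ a))) ⟩
  sel l (lookup (map reflectComp Fh) (cast lm (cast (sym lF) (σ a))))
    ≡⟨ cong (sel l) (lookup-map reflectComp Fh lm _) ⟩
  sel l (reflectComp (lookup Fh (cast (sym lF) (σ a))))
    ≡⟨ cong (sel l ∘ reflectComp) (lookup-F h (sym lF) (σ a)) ⟩
  sel l (reflectComp (pairF (σ a)))
    ≡⟨ sel-reflect l (pairF (σ a)) ⟩
  opposite (sel (flip l) (pairF (σ a)))
    ≡⟨ cong opposite (sel-pairF (flip l) (σ a)) ⟩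
  opposite (chan (σ a) (flip l))
    ≡⟨ cong opposite (sym (twist-chan σ a l)) ⟩
  opposite (twist σ (chan a l))
    ≡⟨ cong (opposite ∘ twist σ) (sym (sel-pairF l a)) ⟩
  opposite (twist σ (sel l (pairF a)))
    ≡⟨ cong (opposite ∘ twist σ ∘ sel l) (sym (lookup-F h (sym lF) a)) ⟩
  opposite (twist σ (sel l (lookup Fh (cast (sym lF) (cast lF i)))))
    ≡⟨ cong (opposite ∘ twist σ ∘ sel l ∘ lookup Fh) (cast-involutive (sym lF) lF i) ⟩
  opposite (twist σ (sel l (lookup Fh i))) ∎
  where
  Fh : Layer (h * 2)
  Fh = F (h * 2)
  lF : length Fh ≡ h
  lF = length-F h
  lm : length Fh ≡ length (map reflectComp Fh)
  lm = sym (length-map reflectComp Fh)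
  a : Fin h
  a = cast lF i

other-end : ∀ {n} {ch : Fin n} (c : Comparator n) → Uses ch c → Fin n
other-end (i , j) (inj₁ _) = j
other-end (i , j) (inj₂ _) = i

other-end-uses : ∀ {n} {ch : Fin n} (c : Comparator n) (u : Uses ch c) → Uses (other-end c u) c
other-end-uses (i , j) (inj₁ _) = inj₂ refl
other-end-uses (i , j) (inj₂ _) = inj₁ refl

other-end-differs : ∀ {n} {ch : Fin n} (c : Comparator n) (u : Uses ch c) →
  proj₁ c ≢ proj₂ c → other-end c u ≢ ch
other-end-differs (i , j) (inj₁ e) i≢j j≡ch = i≢j (trans (sym e) (sym j≡ch))
other-end-differs (i , j) (inj₂ e) i≢j i≡ch = i≢j (trans i≡ch e)

only-two-ends : ∀ {n} {ch x : Fin n} (c : Comparator n) (u : Uses ch c) → Uses x c →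
  x ≡ ch ⊎ x ≡ other-end c u
only-two-ends (i , j) (inj₁ e) (inj₁ e′) = inj₁ (trans e′ (sym e))
only-two-ends (i , j) (inj₁ e) (inj₂ e′) = inj₂ e′
only-two-ends (i , j) (inj₂ e) (inj₁ e′) = inj₂ e′
only-two-ends (i , j) (inj₂ e) (inj₂ e′) = inj₁ (trans e′ (sym e))

uses-channels : ∀ {n} {ch : Fin n} (L : Layer n) b → Uses ch (lookup L b) → ch ∈ channels L
uses-channels (c ∷ L) zero (inj₁ e) = here e
uses-channels (c ∷ L) zero (inj₂ e) = there (here e)
uses-channels (c ∷ L) (suc b) u = there (there (uses-channels L b u))

first-not-later : ∀ {n} {ch : Fin n} (c : Comparator n) (L : Layer n) → Unique (channels (c ∷ L)) →
  Uses ch c → ∀ b → Uses ch (lookup L b) → ⊥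
first-not-later c L (i∉ ∷ j∉ ∷ _) (inj₁ e) b u = All.lookup i∉ (there (uses-channels L b u)) (sym e)
first-not-later c L (i∉ ∷ j∉ ∷ _) (inj₂ e) b u = All.lookup j∉ (uses-channels L b u) (sym e)

unique-comparator : ∀ {n} {ch : Fin n} (L : Layer n) → Unique (channels L) → ∀ b b′ →
  Uses ch (lookup L b) → Uses ch (lookup L b′) → b ≡ b′
unique-comparator (c ∷ L) _ zero zero _ _ = refl
unique-comparator (c ∷ L) distinct zero (suc b′) u u′ = ⊥-elim (first-not-later c L distinct u b′ u′)
unique-comparator (c ∷ L) distinct (suc b) zero u u′ = ⊥-elim (first-not-later c L distinct u′ b u)
unique-comparator (c ∷ L) (_ ∷ _ ∷ distinct) (suc b) (suc b′) u u′ =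
  cong suc (unique-comparator L distinct b b′ u u′)

record IsMatching {n : ℕ} (m : Fin n → Fin n) : Set where
  field
    involutive : Involutive _≡_ m
    no-fixed-point : ∀ x → m x ≢ x

module MatchingLayer {n : ℕ} (L : Layer n) (valid : ValidLayer L) (covers : ∀ ch → UsedBy ch L) where

  slot : Fin n → Fin (length L)
  slot ch = Any.index (proj₁ (proj₂ (covers ch)))

  slot-uses : ∀ ch → Uses ch (lookup L (slot ch))
  slot-uses ch = subst (Uses ch) (lookup-index (proj₁ (proj₂ (covers ch)))) (proj₂ (proj₂ (covers ch)))

  slot-unique : ∀ {ch} b → Uses ch (lookup L b) → b ≡ slot ch
  slot-unique b u = unique-comparator L (proj₂ valid) b _ u (slot-uses _)

  partner : Fin n → Fin n
  partner ch = other-end (lookup L (slot ch)) (slot-uses ch)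

  partner-uses : ∀ ch → Uses (partner ch) (lookup L (slot ch))
  partner-uses ch = other-end-uses (lookup L (slot ch)) (slot-uses ch)

  slot-ends : ∀ {ch x} → Uses x (lookup L (slot ch)) → x ≡ ch ⊎ x ≡ partner ch
  slot-ends {ch} = only-two-ends (lookup L (slot ch)) (slot-uses ch)

  slot-channels : ∀ ch x → Uses x (lookup L (slot ch)) ⇔ (x ≡ ch ⊎ x ≡ partner ch)
  slot-channels ch x = mk⇔ slot-ends λ
    { (inj₁ refl) → slot-uses ch
    ; (inj₂ refl) → partner-uses ch }

  slot-first : ∀ b → slot (proj₁ (lookup L b)) ≡ b
  slot-first b = sym (slot-unique b (inj₁ refl))

  partner-matching : IsMatching partner
  partner-matching = record { involutive = involutive ; no-fixed-point = no-fixed-point }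
    where
    no-fixed-point : ∀ x → partner x ≢ x
    no-fixed-point x = other-end-differs (lookup L (slot x)) (slot-uses x)
      (<⇒≢ (All.lookup (proj₁ valid) (∈-lookup (slot x))))
    -- partner (partner x) lies on slot (partner x) = slot x, so it is x or partner x.
    involutive : Involutive _≡_ partner
    involutive x with slot-ends (subst (λ b → Uses (partner (partner x)) (lookup L b))
                                       (sym (slot-unique (slot x) (partner-uses x)))
                                       (partner-uses (partner x)))
    ... | inj₁ e = e
    ... | inj₂ e = ⊥-elim (no-fixed-point (partner x) e)

  module Transport (π : Fin n → Fin n) (π-inv : Involutive _≡_ π)
    (commutes : ∀ x → partner (π x) ≡ π (partner x)) where

    τ : Fin (length L) → Fin (length L)
    τ b = slot (π (proj₁ (lookup L b)))

    π-pair : ∀ c x → (x ≡ c ⊎ x ≡ partner c) ⇔ (π x ≡ π c ⊎ π x ≡ partner (π c))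
    π-pair c x = mk⇔
      (Sum.map (cong π) (λ e → trans (cong π e) (sym (commutes c))))
      (Sum.map π-injective (λ e → π-injective (trans e (commutes c))))
      where
      π-injective : ∀ {x y} → π x ≡ π y → x ≡ y
      π-injective = involutive-injective {f = π} π-inv

    uses-τ : ∀ ch b → Uses ch (lookup L b) ⇔ Uses (π ch) (lookup L (τ b))
    uses-τ ch b =
      ⇔.trans (subst (λ b′ → Uses ch (lookup L b′) ⇔ (ch ≡ c ⊎ ch ≡ partner c)) (slot-first b)
        (slot-channels c ch))
      (⇔.trans (π-pair c ch) (⇔.sym (slot-channels (π c) (π ch))))
      where
      c : Fin n
      c = proj₁ (lookup L b)

    τ-involutive : Involutive _≡_ τ
    τ-involutive b = sym (slot-unique b (Equivalence.from (uses-τ (π c) b)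
      (subst (λ x → Uses x (lookup L (τ b))) (sym (π-inv c)) (inj₁ refl))))
      where
      c : Fin n
      c = proj₁ (lookup L (τ b))

    reflect-L↔ : Fin (length L) ↔ Fin (length (map reflectComp L))
    reflect-L↔ = involution↔ τ τ-involutive refl (sym (length-map reflectComp L))

    reflect-L : ∀ ch b → Uses ch (lookup L b) ⇔
      Uses (opposite (π ch)) (lookup (map reflectComp L) (Inverse.to reflect-L↔ b))
    reflect-L ch b = ⇔.trans (uses-τ ch b) (⇔.trans (uses-reflect (lookup L (τ b)))
      (subst (λ c → Uses (opposite (π ch)) (reflectComp (lookup L (τ b))) ⇔ Uses (opposite (π ch)) c)
        (sym image) ⇔.refl))
      where
      image : lookup (map reflectComp L) (Inverse.to reflect-L↔ b) ≡ reflectComp (lookup L (τ b))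
      image = begin
        lookup (map reflectComp L) (cast _ (τ (cast refl b)))
          ≡⟨ lookup-map reflectComp L _ _ ⟩
        reflectComp (lookup L (τ (cast refl b)))
          ≡⟨ cong (reflectComp ∘ lookup L ∘ τ) (cast-is-id refl b) ⟩
        reflectComp (lookup L (τ b)) ∎

reflection-symmetric : ∀ h (L : Layer (h * 2)) (valid : ValidLayer L) (covers : ∀ ch → UsedBy ch L) →
  (σ : Fin h → Fin h) → Involutive _≡_ σ →
  (∀ x → MatchingLayer.partner L valid covers (twist σ x) ≡ twist σ (MatchingLayer.partner L valid covers x)) →
  (F (h * 2) ∷ L ∷ []) ≈ reflect (F (h * 2) ∷ L ∷ [])
reflection-symmetric h L valid covers σ σ-inv commutes =
  TwoLayerIsomorphism.isomorphic (opposite ∘ twist σ)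
    (reflect-F↔ h σ σ-inv) reflect-L↔ (reflect-F h σ σ-inv) reflect-L
  where
  open MatchingLayer L valid covers
  open Transport (twist σ) (twist-involutive σ σ-inv) commutes

-- Exhaustive search over the perfect matchings m of n channels, looking for a channel map in
-- the list candidates that commutes with m.  Matchings are built as partial tables, pairing
-- the first unmatched channel with each fresh channel in turn.  The search returns a
-- boolean; search-sound shows that when it succeeds every matching has a commuting
-- candidate, by following the branch of the search that agrees with the given matching.
module MatchingSearch {n : ℕ} (candidates : List (Fin n → Fin n)) where

  Commutes : (Fin n → Fin n) → (Fin n → Fin n) → Set
  Commutes m ρ = ∀ x → m (ρ x) ≡ ρ (m x)

  commutes? : ∀ m ρ → Dec (Commutes m ρ)
  commutes? m ρ = all? λ x → m (ρ x) ≟ ρ (m x)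

  Table : Set
  Table = Fin n → Maybe (Fin n)

  assign : Table → Fin n → Fin n → Table
  assign s x v y = if does (y ≟ x) then just v else if does (y ≟ v) then just x else s y

  assign-elsewhere : ∀ s x v y → y ≢ x → y ≢ v → assign s x v y ≡ s y
  assign-elsewhere s x v y y≢x y≢v rewrite dec-false (y ≟ x) y≢x | dec-false (y ≟ v) y≢v = refl

  fresh : Table → Fin n → Fin n → Bool
  fresh s x v = not (does (v ≟ x)) ∧ is-nothing (s v)

  complete : Table → Fin n → Fin n
  complete s y = fromMaybe y (s y)

  Total : Table → Set
  Total s = ∀ y → T (is-just (s y))

  total? : ∀ s → Dec (Total s)
  total? s = all? λ y → T? (is-just (s y))

  commuting-candidate? : ∀ s → Dec (Any (Commutes (complete s)) candidates)
  commuting-candidate? s = any? (commutes? (complete s)) candidates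

  leaf : Table → Bool
  leaf s = isYes (total? s) ∧ isYes (commuting-candidate? s)

  explore : List (Fin n) → Table → Bool
  explore [] s = leaf s
  explore (x ∷ xs) s with s x
  ... | just _ = explore xs s
  ... | nothing = isYes (all? λ v → T? (if fresh s x v then explore xs (assign s x v) else true))

  search : Bool
  search = explore (allFin n) (λ _ → nothing)

  module Soundness (m : Fin n → Fin n) (matching : IsMatching m) where
    open IsMatching matching

    -- Invariants of the tables on the branch followed: they agree with m, and their
    -- domain is closed under m.
    Agrees : Table → Set
    Agrees s = ∀ y w → s y ≡ just w → w ≡ m y

    Closed : Table → Set
    Closed s = ∀ y → s y ≡ nothing → s (m y) ≡ nothing

    assign-agrees : ∀ s x → Agrees s → Agrees (assign s x (m x))
    assign-agrees s x agrees y w e with y ≟ x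
    ... | yes refl = sym (just-injective e)
    ... | no _ with y ≟ m x
    ...   | yes refl = trans (sym (just-injective e)) (sym (involutive x))
    ...   | no _ = agrees y w e

    assign-closed : ∀ s x → Closed s → Closed (assign s x (m x))
    assign-closed s x closed y e with y ≟ x | y ≟ m x
    ... | no y≢x | no y≢mx = trans (assign-elsewhere s x (m x) (m y) my≢x my≢mx) (closed y e)
      where
      my≢x : m y ≢ x
      my≢x my≡x = y≢mx (trans (sym (involutive y)) (cong m my≡x))
      my≢mx : m y ≢ m x
      my≢mx my≡mx = y≢x (involutive-injective involutive my≡mx)

    fresh-partner : ∀ s x → Closed s → s x ≡ nothing → fresh s x (m x) ≡ true
    fresh-partner s x closed sx rewrite dec-false (m x ≟ x) (no-fixed-point x) | closed x sx = refl

    leaf-sound : ∀ s → Agrees s → T (leaf s) → Any (Commutes m) candidates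
    leaf-sound s agrees t = Any.map commuting (toWitness (proj₂ parts))
      where
      parts : True (total? s) × True (commuting-candidate? s)
      parts = Equivalence.to (T-∧ {isYes (total? s)}) t
      total : Total s
      total = toWitness (proj₁ parts)
      completes : ∀ y → complete s y ≡ m y
      completes y with s y in sy
      ... | just w = agrees y w sy
      ... | nothing = ⊥-elim (subst (T ∘ is-just) sy (total y))
      commuting : ∀ {ρ} → Commutes (complete s) ρ → Commutes m ρ
      commuting {ρ} c x = begin
        m (ρ x)             ≡⟨ sym (completes (ρ x)) ⟩
        complete s (ρ x)    ≡⟨ c x ⟩
        ρ (complete s x)    ≡⟨ cong ρ (completes x) ⟩
        ρ (m x)             ∎

    explore-sound : ∀ xs s → Agrees s → Closed s → T (explore xs s) → Any (Commutes m) candidates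
    explore-sound [] s agrees closed t = leaf-sound s agrees t
    explore-sound (x ∷ xs) s agrees closed t with s x in sx
    ... | just _ = explore-sound xs s agrees closed t
    ... | nothing = explore-sound xs (assign s x (m x))
      (assign-agrees s x agrees) (assign-closed s x closed)
      (subst (λ b → T (if b then explore xs (assign s x (m x)) else true))
        (fresh-partner s x closed sx) (toWitness t (m x)))

    -- Stated for search ≡ true, so that the premise can be discharged by evaluation (refl).
    search-sound : search ≡ true → Any (Commutes m) candidates
    search-sound succeeds = explore-sound (allFin n) (λ _ → nothing) (λ _ _ ()) (λ _ _ → refl)
      (Equivalence.from T-≡ succeeds)

functions : ∀ h k → List (Fin h → Fin k)
functions zero k = (λ ()) ∷ []
functions (suc h) k = concatMap (λ f → map (_◂ f) (allFin k)) (functions h k)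

involutive? : ∀ {h} (σ : Fin h → Fin h) → Dec (Involutive _≡_ σ)
involutive? σ = all? λ a → σ (σ a) ≟ a

twist-candidates : ∀ h → List (Fin (h * 2) → Fin (h * 2))
twist-candidates h = map twist (filter involutive? (functions h h))

twist-search-succeeds : ∀ h → h < 6 → MatchingSearch.search (twist-candidates h) ≡ true
twist-search-succeeds 0 _ = refl
twist-search-succeeds 1 _ = refl
twist-search-succeeds 2 _ = refl
twist-search-succeeds 3 _ = refl
twist-search-succeeds 4 _ = refl
twist-search-succeeds 5 _ = refl
twist-search-succeeds (suc (suc (suc (suc (suc (suc _)))))) (s≤s (s≤s (s≤s (s≤s (s≤s (s≤s ()))))))

small-matching-twist : ∀ h → h < 6 → (m : Fin (h * 2) → Fin (h * 2)) → IsMatching m →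
  Σ (Fin h → Fin h) λ σ → Involutive _≡_ σ × (∀ x → m (twist σ x) ≡ twist σ (m x))
small-matching-twist h h<6 m matching
  with find (Soundness.search-sound m matching (twist-search-succeeds h h<6))
  where open MatchingSearch (twist-candidates h)
... | ρ , ρ∈ , commutes with ∈-map⁻ twist ρ∈
... | σ , σ∈ , refl = σ , proj₂ (∈-filter⁻ involutive? {xs = functions h h} σ∈) , commutes

lemma9 : (n : ℕ) → 2 ∣ n → n < 12 →
    (L₂ : Layer n) → ValidLayer L₂ →
    (∀ (ch : Fin n) → UsedBy ch L₂) →
    Connected (F n ∷ L₂ ∷ []) →
    (F n ∷ L₂ ∷ []) ≈ reflect (F n ∷ L₂ ∷ [])
lemma9 .(h * 2) (divides h refl) h*2<12 L₂ valid covers _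
  with small-matching-twist h (*-cancelʳ-< 2 h 6 h*2<12)
         (MatchingLayer.partner L₂ valid covers) (MatchingLayer.partner-matching L₂ valid covers)
... | σ , σ-involutive , commutes = reflection-symmetric h L₂ valid covers σ σ-involutive commutes
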